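{- Let $n_1,\dots,n_m$ be even integers with $n_i\ge 4$, and let $\mathcal{C}=\mathcal{C}(C_{n_1},\dots,C_{n_m})$ be the chain cycle obtained by identifying $v^i_{\frac{n_i}{2}+1}$ with $v^{i+1}_1$ for each $i=1,\dots,m-1$. Let $V_1=\{v^2_1,\dots,v^m_1\}$ and $V_2=V(\mathcal{C})\setminus V_1$. Let $v^i_j,v^k_l\in V_2$ with $i,k\in\{1,\dots,m\}$. (a) If $i=k$, then $v^i_j$ and $v^i_l$ are mutually maximally distant if and only if $d(v^i_j,v^i_l)$ equals the diameter of $C_{n_i}$. (b) If $i\ne k$, then $v^i_j$ and $v^k_l$ are mutually maximally distant if and only if $d(v^i_j,v^k_l)$ equals the diameter of $\mathcal{C}$.
   Context: The cycles $C_{n_1},\dots,C_{n_m}$ are pairwise disjoint, $V(C_{n_i})=\{v^i_1,\dots,v^i_{n_i}\}$ with $v^i_j$ adjacent to $v^i_{j+1}$ ($1\le j<n_i$) and $v^i_{n_i}$ adjacent to $v^i_1$; the chain cycle is obtained from their disjoint union by the stated identifications, and $d$ denotes the shortest-path distance in $\mathcal{C}$. A vertex $u$ is maximally distant from $v$ if $d(v,w)\le d(u,v)$ for every neighbor $w$ of $u$; $u$ and $v$ are mutually maximally distant if each is maximally distant from the other. The diameter of a graph is the maximum distance between two of its vertices. -}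

module Defs where

open import Data.Nat using (ℕ; zero; suc; _≤_; _<_; _/_)
open import Data.Fin using (Fin; toℕ)
open import Data.Product using (Σ; Σ-syntax; ∃; ∃-syntax; _×_; _,_; proj₁)
open import Data.Sum using (_⊎_)
open import Relation.Nullary using (¬_)
open import Relation.Binary.PropositionalEquality using (_≡_)
open import Relation.Binary.Construct.Closure.Equivalence using (EqClosure)

-- Generic (undirected) graphs, given by a vertex type, a vertex
-- equality (needed to model vertex identification) and adjacency.

record Graph : Set₁ where
  field
    V   : Set
    _≈_ : V → V → Set
    Adj : V → V → Set

module _ (G : Graph) where
  open Graph G

  data Walk : V → V → ℕ → Set where
    here : ∀ {u v} → u ≈ v → Walk u v 0
    step : ∀ {u w v k} → Adj u w → Walk w v k → Walk u v (suc k)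

  Dist : V → V → ℕ → Set
  Dist u v k = Walk u v k × (∀ k' → Walk u v k' → k ≤ k')

  IsDiameter : ℕ → Set
  IsDiameter D = (Σ[ u ∈ V ] Σ[ v ∈ V ] Dist u v D)
               × (∀ u v k → Dist u v k → k ≤ D)

  MaxDistFrom : V → V → Set
  MaxDistFrom u v = ∀ w → Adj u w → ∀ a b → Dist v w a → Dist u v b → a ≤ b

  MutuallyMaxDist : V → V → Set
  MutuallyMaxDist u v = MaxDistFrom u v × MaxDistFrom v u

-- Cycles.  Vertex v_j (1 ≤ j ≤ N) is represented by position j-1 < N.
-- Positions a, b are adjacent iff they are consecutive modulo N.

CycAdj : ℕ → ℕ → ℕ → Set
CycAdj N a b = (suc a ≡ b) ⊎ (suc b ≡ a)
             ⊎ ((a ≡ 0 × suc b ≡ N) ⊎ (b ≡ 0 × suc a ≡ N))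

CycleGraph : ℕ → Graph
CycleGraph N = record
  { V   = Σ ℕ (λ j → j < N)
  ; _≈_ = λ x y → proj₁ x ≡ proj₁ y
  ; Adj = λ x y → CycAdj N (proj₁ x) (proj₁ y)
  }

-- Chain cycle C(C_{n_1},...,C_{n_m}).  Raw vertex v^i_j is
-- cv (i-1) (j-1) _ ; blocks indexed by Fin m, positions 0-indexed.

record CV (m : ℕ) (n : Fin m → ℕ) : Set where
  constructor cv
  field
    blk   : Fin m
    pos   : ℕ
    pos<n : pos < n blk
open CV public

-- the identification  v^i_{n_i/2+1} = v^{i+1}_1  (0-indexed: position
-- n_i/2 of block i with position 0 of block i+1)
Glue : (m : ℕ) (n : Fin m → ℕ) → CV m n → CV m n → Set
Glue m n x y = (toℕ (blk y) ≡ suc (toℕ (blk x)))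
             × (pos x ≡ n (blk x) / 2) × (pos y ≡ 0)

_≈C_ : {m : ℕ} {n : Fin m → ℕ} → CV m n → CV m n → Set
_≈C_ {m} {n} = EqClosure (Glue m n)

ChainAdj : (m : ℕ) (n : Fin m → ℕ) → CV m n → CV m n → Set
ChainAdj m n x y = Σ[ x' ∈ CV m n ] Σ[ y' ∈ CV m n ]
  (x ≈C x') × (y ≈C y') × (blk x' ≡ blk y')
  × CycAdj (n (blk x')) (pos x') (pos y')

ChainCycle : (m : ℕ) (n : Fin m → ℕ) → Graph
ChainCycle m n = record
  { V   = CV m n
  ; _≈_ = _≈C_
  ; Adj = ChainAdj m n
  }

-- V_1 = { v^2_1, ..., v^m_1 }  (blocks with 0-index ≥ 1, position 0)
InV1 : (m : ℕ) (n : Fin m → ℕ) → CV m n → Set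
InV1 m n x = Σ[ i ∈ Fin m ] (1 ≤ toℕ i) × Σ[ p ∈ 0 < n i ] (x ≈C cv i 0 p)

InV2 : (m : ℕ) (n : Fin m → ℕ) → CV m n → Set
InV2 m n x = ¬ InV1 m n x

module Submission where

-- Distances are certified by potentials: a function on vertices that respects vertex
-- identification and grows by at most one along each edge bounds walk lengths from
-- below, so a walk along which it increases at every step is a shortest walk.  In an
-- even cycle C_{2h} the distance from position 0, transported by rotations, yields the
-- cycle distance, which is at most h = the diameter of C_{2h}.  On the chain two
-- potentials are used: the level (offset of the block plus distance from its first
-- vertex) measures distances between different blocks through ascending walks, and the
-- cycle distance after projecting onto one block measures distances inside a block.
-- Hence the chain has diameter Σ n_i/2, realised by its two ends.
-- (a) A V₂-vertex has all its neighbours in its own block, so antipodal vertices are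
--     mutually maximally distant, while a non-antipodal one has a farther neighbour.
-- (b) For blocks i < k a non-extreme endpoint has a neighbour one step farther from the
--     other endpoint, and the extreme positions of inner blocks are glued, i.e. in V₁;
--     so mutually maximally distant V₂-vertices are the two ends of the chain.

open import Defs
open import Data.Nat
open import Data.Nat.Properties
open import Data.Nat.Divisibility using (_∣_)
open import Data.Nat.DivMod using (m*[n/m]≡n)
open import Data.Fin using (Fin; toℕ; fromℕ; fromℕ<) renaming (zero to fzero; suc to fsuc)
open import Data.Fin.Properties using (toℕ-injective; toℕ<n; toℕ-fromℕ; toℕ-fromℕ<)
open import Data.Product using (Σ; _×_; _,_; proj₁; proj₂)
open import Data.Sum using (inj₁; inj₂)
open import Data.Empty using (⊥-elim)
open import Function.Bundles using (_⇔_; mk⇔)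
open import Relation.Nullary using (¬_; yes; no)
open import Relation.Binary.Definitions using (tri<; tri≈; tri>)
open import Relation.Binary.PropositionalEquality
open import Relation.Binary.Construct.Closure.ReflexiveTransitive using (ε; _◅_; _◅◅_)
open import Relation.Binary.Construct.Closure.Symmetric using (fwd; bwd)
import Relation.Binary.Construct.Closure.Equivalence as EqClosure

dist₀ : ℕ → ℕ → ℕ
dist₀ N x = x ⊓ (N ∸ x)

CycAdj-sym : ∀ {N a b} → CycAdj N a b → CycAdj N b a
CycAdj-sym (inj₁ e)               = inj₂ (inj₁ e)
CycAdj-sym (inj₂ (inj₁ e))        = inj₁ e
CycAdj-sym (inj₂ (inj₂ (inj₁ e))) = inj₂ (inj₂ (inj₂ e))
CycAdj-sym (inj₂ (inj₂ (inj₂ e))) = inj₂ (inj₂ (inj₁ e))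

∸-suc-≤ : ∀ N a → N ∸ a ≤ suc (N ∸ suc a)
∸-suc-≤ zero    a       = ≤-trans (≤-reflexive (0∸n≡0 a)) z≤n
∸-suc-≤ (suc N) zero    = ≤-refl
∸-suc-≤ (suc N) (suc a) = ∸-suc-≤ N a

dist₀-lipschitz : ∀ N {a b} → CycAdj N a b → dist₀ N a ≤ suc (dist₀ N b)
dist₀-lipschitz N {a} (inj₁ refl) =
  ⊓-mono-≤ (≤-trans (n≤1+n a) (n≤1+n (suc a))) (∸-suc-≤ N a)
dist₀-lipschitz N {b = b} (inj₂ (inj₁ refl)) =
  ⊓-mono-≤ ≤-refl (≤-trans (∸-monoʳ-≤ N (n≤1+n b)) (n≤1+n (N ∸ b)))
dist₀-lipschitz N (inj₂ (inj₂ (inj₁ (refl , _)))) = z≤n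
dist₀-lipschitz .(suc a) {a} (inj₂ (inj₂ (inj₂ (refl , refl)))) =
  ≤-trans (m⊓n≤n a (suc a ∸ a)) (≤-reflexive (m+n∸n≡m 1 a))

module _ (h : ℕ) where

  dist₀-low : ∀ {x} → x ≤ h → dist₀ (h + h) x ≡ x
  dist₀-low {x} x≤h =
    m≤n⇒m⊓n≡m (≤-trans x≤h (≤-trans (≤-reflexive (sym (m+n∸n≡m h h))) (∸-monoʳ-≤ (h + h) x≤h)))

  high-≤ : ∀ {x} → h ≤ x → h + h ∸ x ≤ h
  high-≤ h≤x = ≤-trans (∸-monoʳ-≤ (h + h) h≤x) (≤-reflexive (m+n∸n≡m h h))

  high-< : ∀ {x} → h < x → x ≤ h + h → h + h ∸ x < h
  high-< {x} h<x x≤N = ≰⇒> λ h≤N∸x → <⇒≱ h<x (+-cancelˡ-≤ h x h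
    (≤-trans (+-monoˡ-≤ x h≤N∸x) (≤-reflexive (m∸n+n≡m x≤N))))

  dist₀-high : ∀ {x} → h ≤ x → dist₀ (h + h) x ≡ h + h ∸ x
  dist₀-high h≤x = m≥n⇒m⊓n≡n (≤-trans (high-≤ h≤x) h≤x)

∸-suc : ∀ N x → suc x ≤ N → N ∸ x ≡ suc (N ∸ suc x)
∸-suc (suc N) zero    _         = refl
∸-suc (suc N) (suc x) (s≤s x<N) = ∸-suc N x x<N

half<N : ∀ {N h} → N ≡ h + h → 1 ≤ N → h < N
half<N {h = zero}  refl ()
half<N {h = suc h} refl _ = s≤s (m≤n+m (suc h) h)

dist₀-≤-half : ∀ {N h} → N ≡ h + h → ∀ x → dist₀ N x ≤ h
dist₀-≤-half {h = h} refl x with x ≤? h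
... | yes x≤h = ≤-trans (m⊓n≤m x _) x≤h
... | no  x≰h = ≤-trans (m⊓n≤n x _) (high-≤ h (<⇒≤ (≰⇒> x≰h)))

dist₀-half : ∀ {N h} → N ≡ h + h → dist₀ N h ≡ h
dist₀-half {h = h} refl = dist₀-low h ≤-refl

dist₀≡half⇒antipode : ∀ {N h x} → N ≡ h + h → x < N → dist₀ N x ≡ h → x ≡ h
dist₀≡half⇒antipode {h = h} {x} refl x<N e with x ≤? h
... | yes x≤h = trans (sym (dist₀-low h x≤h)) e
... | no  x≰h = ⊥-elim (<-irrefl e (subst (_< h) (sym (dist₀-high h (<⇒≤ h<x))) (high-< h h<x (<⇒≤ x<N))))
  where h<x = ≰⇒> x≰h

away-from-0 : ∀ {N h x} → N ≡ h + h → x < N → dist₀ N x < h →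
              Σ ℕ λ x' → x' < N × CycAdj N x x' × dist₀ N x' ≡ suc (dist₀ N x)
away-from-0 {h = h} {x} refl x<N d<h with x ≤? h
... | yes x≤h = suc x , sx<N , inj₁ refl , trans (dist₀-low h sx≤h) (cong suc (sym (dist₀-low h x≤h)))
  where
  sx≤h : suc x ≤ h
  sx≤h = subst (_< h) (dist₀-low h x≤h) d<h
  sx<N : suc x < h + h
  sx<N = ≤-trans (s≤s (m≤n+m (suc x) x)) (+-mono-≤ sx≤h sx≤h)
... | no x≰h with ≰⇒> x≰h
... | h<x@(s≤s {n = x'} h≤x') = x' , ≤-trans (n≤1+n (suc x')) x<N , inj₂ (inj₁ refl) ,
      trans (dist₀-high h h≤x')
        (trans (∸-suc (h + h) x' (≤-trans (n≤1+n _) x<N)) (cong suc (sym (dist₀-high h (<⇒≤ h<x)))))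

towards-0 : ∀ {N h x} → N ≡ h + h → x < N → x ≢ 0 →
            Σ ℕ λ x' → x' < N × CycAdj N x x' × suc (dist₀ N x') ≡ dist₀ N x
towards-0 {x = zero} refl _ x≢0 = ⊥-elim (x≢0 refl)
towards-0 {h = h} {suc x} refl x<N _ with suc x ≤? h
... | yes sx≤h = x , ≤-trans (n≤1+n (suc x)) x<N , inj₂ (inj₁ refl) ,
      trans (cong suc (dist₀-low h (≤-trans (n≤1+n x) sx≤h))) (sym (dist₀-low h sx≤h))
... | no sx≰h with suc (suc x) ≟ h + h
...   | yes wraps = 0 , ≤-trans (s≤s z≤n) x<N , inj₂ (inj₂ (inj₂ (refl , wraps))) ,
        sym (trans (dist₀-high h h≤sx) (trans (cong (_∸ suc x) (sym wraps)) (m+n∸n≡m 1 (suc x))))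
  where h≤sx = <⇒≤ (≰⇒> sx≰h)
...   | no  ¬wraps = suc (suc x) , ≤∧≢⇒< x<N ¬wraps , inj₁ refl ,
        trans (cong suc (dist₀-high h (≤-trans h≤sx (n≤1+n _))))
          (trans (sym (∸-suc (h + h) (suc x) x<N)) (sym (dist₀-high h h≤sx)))
  where h≤sx = <⇒≤ (≰⇒> sx≰h)

data PosWalk (N : ℕ) : ℕ → ℕ → ℕ → Set where
  nil  : ∀ {a} → PosWalk N a a 0
  cons : ∀ {a b d k} → b < N → CycAdj N a b → PosWalk N b d k → PosWalk N a d (suc k)

walk-up : ∀ N a k → a + k < N → PosWalk N a (a + k) k
walk-up N a zero    _  = subst (λ z → PosWalk N a z 0) (sym (+-identityʳ a)) nil
walk-up N a (suc k) lt rewrite +-suc a k =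
  cons (≤-trans (s≤s (s≤s (m≤m+n a k))) lt) (inj₁ refl) (walk-up N (suc a) k lt)

walk-down : ∀ N a k → k + a < N → PosWalk N (k + a) a k
walk-down N a zero    _  = nil
walk-down N a (suc k) lt =
  cons (≤-trans (n≤1+n _) lt) (inj₂ (inj₁ refl)) (walk-down N a k (≤-trans (n≤1+n _) lt))

walk-from-0 : ∀ {N h x} → N ≡ h + h → x < N → PosWalk N 0 x (dist₀ N x)
walk-from-0 {h = h} {x} refl x<N with x ≤? h
... | yes x≤h = subst (PosWalk (h + h) 0 x) (sym (dist₀-low h x≤h)) (walk-up (h + h) 0 x x<N)
... | no  x≰h = subst (PosWalk (h + h) 0 x) (sym (trans (dist₀-high h (<⇒≤ (≰⇒> x≰h))) (∸-suc (h + h) x x<N)))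
                  (cons (≤-reflexive wrap) (inj₂ (inj₂ (inj₁ (refl , wrap))))
                    (walk-down (h + h) x k (≤-reflexive wrap)))
  where
  -- go backwards: 0 → N - 1 → … → x
  k = h + h ∸ suc x
  wrap : suc (k + x) ≡ h + h
  wrap = trans (sym (+-suc k x)) (m∸n+n≡m x<N)

walk-to-antipode : ∀ {N h p} → N ≡ h + h → p < N → Σ ℕ λ L → PosWalk N p h L × dist₀ N p + L ≡ h
walk-to-antipode {h = h} {p} refl p<N with p ≤? h
... | yes p≤h = h ∸ p ,
      subst (λ z → PosWalk (h + h) p z (h ∸ p)) (m+[n∸m]≡n p≤h)
        (walk-up (h + h) p (h ∸ p)
          (subst (_< h + h) (sym (m+[n∸m]≡n p≤h)) (half<N refl (≤-trans (s≤s z≤n) p<N)))) ,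
      trans (cong (_+ (h ∸ p)) (dist₀-low h p≤h)) (m+[n∸m]≡n p≤h)
... | no p≰h = p ∸ h ,
      subst (λ z → PosWalk (h + h) z h (p ∸ h)) (m∸n+n≡m h≤p)
        (walk-down (h + h) h (p ∸ h) (subst (_< h + h) (sym (m∸n+n≡m h≤p)) p<N)) ,
      +-cancelʳ-≡ _ _ h total
  where
  h≤p = <⇒≤ (≰⇒> p≰h)
  open ≡-Reasoning
  total : dist₀ (h + h) p + (p ∸ h) + h ≡ h + h
  total = begin
    dist₀ (h + h) p + (p ∸ h) + h   ≡⟨ +-assoc (dist₀ (h + h) p) (p ∸ h) h ⟩
    dist₀ (h + h) p + (p ∸ h + h)   ≡⟨ cong₂ _+_ (dist₀-high h h≤p) (m∸n+n≡m h≤p) ⟩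
    (h + h ∸ p) + p                 ≡⟨ m∸n+n≡m (<⇒≤ p<N) ⟩
    h + h                           ∎

rot⁻ : ℕ → ℕ → ℕ
rot⁻ N zero    = pred N
rot⁻ N (suc x) = x

rot⁺ : ℕ → ℕ → ℕ
rot⁺ N x with suc x ≟ N
... | yes _ = 0
... | no  _ = suc x

rot⁺-inner : ∀ N x → suc x < N → rot⁺ N x ≡ suc x
rot⁺-inner N x lt with suc x ≟ N
... | yes e = ⊥-elim (<-irrefl e lt)
... | no  _ = refl

rot⁺-wrap : ∀ N x → suc x ≡ N → rot⁺ N x ≡ 0
rot⁺-wrap N x e with suc x ≟ N
... | yes _  = refl
... | no  ne = ⊥-elim (ne e)

rot⁻-< : ∀ {N x} → 1 ≤ N → x < N → rot⁻ N x < N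
rot⁻-< {suc N} {zero}  _ _  = ≤-refl
rot⁻-< {suc N} {suc x} _ lt = ≤-trans (n≤1+n _) lt

rot⁺-< : ∀ {N x} → 1 ≤ N → x < N → rot⁺ N x < N
rot⁺-< {N} {x} 1≤N lt with suc x ≟ N
... | yes _  = 1≤N
... | no  ne = ≤∧≢⇒< lt ne

rot⁺-rot⁻ : ∀ {N x} → x < N → rot⁺ N (rot⁻ N x) ≡ x
rot⁺-rot⁻ {suc N} {zero}  _  = rot⁺-wrap (suc N) N refl
rot⁺-rot⁻ {suc N} {suc x} lt = rot⁺-inner (suc N) x lt

rot⁻-rot⁺ : ∀ {N x} → x < N → rot⁻ N (rot⁺ N x) ≡ x
rot⁻-rot⁺ {N} {x} lt with suc x ≟ N
rot⁻-rot⁺ {suc N} lt | yes refl = refl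
...                  | no  _    = refl

rot⁻-adj : ∀ {N a b} → 1 ≤ N → CycAdj N a b → CycAdj N (rot⁻ N a) (rot⁻ N b)
rot⁻-adj {suc N} _ = go
  where
  succ : ∀ {a} → CycAdj (suc N) (rot⁻ (suc N) a) (rot⁻ (suc N) (suc a))
  succ {zero}  = inj₂ (inj₂ (inj₂ (refl , refl)))
  succ {suc a} = inj₁ refl
  wrap : ∀ {b} → suc b ≡ suc N → CycAdj (suc N) (rot⁻ (suc N) 0) (rot⁻ (suc N) b)
  wrap {zero}  refl = inj₂ (inj₂ (inj₁ (refl , refl)))
  wrap {suc b} refl = inj₂ (inj₁ refl)
  go : ∀ {a b} → CycAdj (suc N) a b → CycAdj (suc N) (rot⁻ (suc N) a) (rot⁻ (suc N) b)
  go (inj₁ refl)                       = succ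
  go (inj₂ (inj₁ refl))                = CycAdj-sym succ
  go (inj₂ (inj₂ (inj₁ (refl , e))))   = wrap e
  go (inj₂ (inj₂ (inj₂ (refl , e))))   = CycAdj-sym (wrap e)

rot⁺-adj : ∀ {N a b} → a < N → b < N → CycAdj N a b → CycAdj N (rot⁺ N a) (rot⁺ N b)
rot⁺-adj {N} a< b< = go a< b<
  where
  succ : ∀ {a} → suc a < N → CycAdj N (rot⁺ N a) (rot⁺ N (suc a))
  succ {a} lt rewrite rot⁺-inner N a lt with suc (suc a) ≟ N
  ... | yes e = inj₂ (inj₂ (inj₂ (refl , e)))
  ... | no  _ = inj₁ refl
  wrap : ∀ {b} → suc b ≡ N → CycAdj N (rot⁺ N 0) (rot⁺ N b)
  wrap {b} e rewrite rot⁺-wrap N b e with 1 ≟ N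
  ... | yes e1 = inj₂ (inj₂ (inj₁ (refl , e1)))
  ... | no  _  = inj₂ (inj₁ refl)
  go : ∀ {a b} → a < N → b < N → CycAdj N a b → CycAdj N (rot⁺ N a) (rot⁺ N b)
  go _  b< (inj₁ refl)                     = succ b<
  go a< _  (inj₂ (inj₁ refl))              = CycAdj-sym (succ a<)
  go _  _  (inj₂ (inj₂ (inj₁ (refl , e)))) = wrap e
  go _  _  (inj₂ (inj₂ (inj₂ (refl , e)))) = CycAdj-sym (wrap e)

shift⁻ : ℕ → ℕ → ℕ → ℕ
shift⁻ N zero    x = x
shift⁻ N (suc q) x = shift⁻ N q (rot⁻ N x)

shift⁺ : ℕ → ℕ → ℕ → ℕ
shift⁺ N zero    x = x
shift⁺ N (suc q) x = rot⁺ N (shift⁺ N q x)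

shift⁻-< : ∀ {N} q {x} → 1 ≤ N → x < N → shift⁻ N q x < N
shift⁻-< zero    _   lt = lt
shift⁻-< (suc q) 1≤N lt = shift⁻-< q 1≤N (rot⁻-< 1≤N lt)

shift⁺-< : ∀ {N} q {x} → 1 ≤ N → x < N → shift⁺ N q x < N
shift⁺-< zero    _   lt = lt
shift⁺-< (suc q) 1≤N lt = rot⁺-< 1≤N (shift⁺-< q 1≤N lt)

shift⁻-adj : ∀ {N} q {a b} → 1 ≤ N → CycAdj N a b → CycAdj N (shift⁻ N q a) (shift⁻ N q b)
shift⁻-adj zero    _   adj = adj
shift⁻-adj (suc q) 1≤N adj = shift⁻-adj q 1≤N (rot⁻-adj 1≤N adj)

shift⁺-adj : ∀ {N} q {a b} → 1 ≤ N → a < N → b < N → CycAdj N a b → CycAdj N (shift⁺ N q a) (shift⁺ N q b)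
shift⁺-adj zero    _   _  _  adj = adj
shift⁺-adj (suc q) 1≤N a< b< adj = rot⁺-adj (shift⁺-< q 1≤N a<) (shift⁺-< q 1≤N b<) (shift⁺-adj q 1≤N a< b< adj)

shift⁻-shift⁺ : ∀ {N} q {x} → 1 ≤ N → x < N → shift⁻ N q (shift⁺ N q x) ≡ x
shift⁻-shift⁺ zero    _   _  = refl
shift⁻-shift⁺ (suc q) 1≤N lt rewrite rot⁻-rot⁺ (shift⁺-< q 1≤N lt) = shift⁻-shift⁺ q 1≤N lt

shift⁺-shift⁻ : ∀ {N} q {x} → 1 ≤ N → x < N → shift⁺ N q (shift⁻ N q x) ≡ x
shift⁺-shift⁻ zero    _   _  = refl
shift⁺-shift⁻ (suc q) 1≤N lt rewrite shift⁺-shift⁻ q 1≤N (rot⁻-< 1≤N lt) = rot⁺-rot⁻ lt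

shift⁻-self : ∀ N q → shift⁻ N q q ≡ 0
shift⁻-self N zero    = refl
shift⁻-self N (suc q) = shift⁻-self N q

shift⁺-0 : ∀ N q → q < N → shift⁺ N q 0 ≡ q
shift⁺-0 N zero    _  = refl
shift⁺-0 N (suc q) lt rewrite shift⁺-0 N q (≤-trans (n≤1+n _) lt) = rot⁺-inner N q lt

map-walk : ∀ {N} (f : ℕ → ℕ) → (∀ {x} → x < N → f x < N)
         → (∀ {a b} → a < N → b < N → CycAdj N a b → CycAdj N (f a) (f b))
         → ∀ {a b k} → a < N → PosWalk N a b k → PosWalk N (f a) (f b) k
map-walk f f< f-adj a< nil                = nil
map-walk f f< f-adj a< (cons b< adj walk) = cons (f< b<) (f-adj a< b< adj) (map-walk f f< f-adj b< walk)

-- The distance from q to p in C_N: rotate q to 0.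
cycDist : ℕ → ℕ → ℕ → ℕ
cycDist N q p = dist₀ N (shift⁻ N q p)

cycDist-self : ∀ N q → cycDist N q q ≡ 0
cycDist-self N q = cong (dist₀ N) (shift⁻-self N q)

cycDist-≤-half : ∀ {N h} → N ≡ h + h → ∀ q p → cycDist N q p ≤ h
cycDist-≤-half even q p = dist₀-≤-half even (shift⁻ _ q p)

cycDist-lipschitz : ∀ {N} q {a b} → 1 ≤ N → CycAdj N a b → cycDist N q a ≤ suc (cycDist N q b)
cycDist-lipschitz {N} q 1≤N adj = dist₀-lipschitz N (shift⁻-adj q 1≤N adj)

-- q reaches p by a walk of length cycDist N q p: the rotated image of the walk from 0.
cycDist-walk : ∀ {N h p q} → N ≡ h + h → 1 ≤ N → p < N → q < N → PosWalk N q p (cycDist N q p)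
cycDist-walk {N} {h} {p} {q} even 1≤N p< q< =
  subst₂ (λ s t → PosWalk N s t (cycDist N q p)) (shift⁺-0 N q q<) (shift⁺-shift⁻ q 1≤N p<)
    (map-walk (shift⁺ N q) (shift⁺-< q 1≤N) (shift⁺-adj q 1≤N) (≤-trans (s≤s z≤n) 1≤N)
      (walk-from-0 {N} {h} even (shift⁻-< q 1≤N p<)))

cycDist-away : ∀ {N h p} q → N ≡ h + h → 1 ≤ N → p < N → cycDist N q p < h →
               Σ ℕ λ p' → p' < N × CycAdj N p p' × cycDist N q p' ≡ suc (cycDist N q p)
cycDist-away {N} {p = p} q even 1≤N p< d<h =
  shift⁺ N q x' , shift⁺-< q 1≤N x'< ,
  subst (λ z → CycAdj N z (shift⁺ N q x')) (shift⁺-shift⁻ q 1≤N p<)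
    (shift⁺-adj q 1≤N (shift⁻-< q 1≤N p<) x'< adj) ,
  trans (cong (dist₀ N) (shift⁻-shift⁺ q 1≤N x'<)) farther
  where
  F = away-from-0 even (shift⁻-< q 1≤N p<) d<h
  x' = proj₁ F
  x'< = proj₁ (proj₂ F)
  adj = proj₁ (proj₂ (proj₂ F))
  farther = proj₂ (proj₂ (proj₂ F))

module _ (G : Graph) where
  open Graph G

  Dist-unique : ∀ {u v a b} → Dist G u v a → Dist G u v b → a ≡ b
  Dist-unique (walk , shortest) (walk' , shortest') = ≤-antisym (shortest _ walk') (shortest' _ walk)

  diameter-unique : ∀ {D D'} → IsDiameter G D → IsDiameter G D' → D ≡ D'
  diameter-unique ((u , v , d) , maximal) ((u' , v' , d') , maximal') =
    ≤-antisym (maximal' u v _ d) (maximal u' v' _ d')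

  farther-neighbour : ∀ {u v w b} → Adj u w → Dist G v w (suc b) → Dist G u v b → ¬ MaxDistFrom G u v
  farther-neighbour {w = w} adj dvw duv maxDist = 1+n≰n (maxDist w adj _ _ dvw duv)

  diametral⇒mutuallyMaxDist : ∀ {D u v} → IsDiameter G D → Dist G u v D → Dist G v u D → MutuallyMaxDist G u v
  diametral⇒mutuallyMaxDist (_ , maximal) duv dvu =
    (λ _ _ a _ dvw duv' → subst (a ≤_) (Dist-unique duv duv') (maximal _ _ _ dvw)) ,
    (λ _ _ a _ duw dvu' → subst (a ≤_) (Dist-unique dvu dvu') (maximal _ _ _ duw))

  module Potential (f : V → ℕ) (f-resp : ∀ {x y} → x ≈ y → f x ≡ f y)
                   (f-lipschitz : ∀ {x y} → Adj x y → f y ≤ suc (f x)) where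

    potential-bound : ∀ {x y k} → Walk G x y k → f y ≤ k + f x
    potential-bound (here e) = ≤-reflexive (sym (f-resp e))
    potential-bound {x} {k = suc k} (step adj walk) =
      ≤-trans (potential-bound walk) (≤-trans (+-monoʳ-≤ k (f-lipschitz adj)) (≤-reflexive (+-suc k (f x))))

    tight⇒Dist : ∀ {x y L} → Walk G x y L → f x + L ≡ f y → Dist G x y L
    tight⇒Dist {x} {L = L} walk tight = walk , λ k walk' →
      +-cancelʳ-≤ (f x) L k (subst (_≤ k + f x) (trans (sym tight) (+-comm (f x) L)) (potential-bound walk'))

PosWalk⇒Walk : ∀ {N a d k} → PosWalk N a d k → (pa : a < N) (pd : d < N) → Walk (CycleGraph N) (a , pa) (d , pd) k
PosWalk⇒Walk nil                pa pd = here refl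
PosWalk⇒Walk (cons b< adj walk) pa pd = step adj (PosWalk⇒Walk walk b< pd)

cycle-diameter : ∀ {N h} → N ≡ h + h → 1 ≤ N → IsDiameter (CycleGraph N) h
cycle-diameter {N} {h} even 1≤N =
  ((0 , 1≤N) , (h , h<N) , tight⇒Dist (PosWalk⇒Walk (walk-up N 0 h h<N) _ _) (sym (dist₀-half even))) ,
  λ u v k d → ≤-trans (proj₂ d _ (PosWalk⇒Walk (cycDist-walk {h = h} even 1≤N (proj₂ v) (proj₂ u)) _ _))
                      (cycDist-≤-half even (proj₁ u) (proj₁ v))
  where
  h<N = half<N even 1≤N
  open Potential (CycleGraph N) (λ x → dist₀ N (proj₁ x)) (cong (dist₀ N))
                 (λ adj → dist₀-lipschitz N (CycAdj-sym adj))

-- Reading a Fin m-indexed family at a natural number (0 out of range), so that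
-- prefix sums over the blocks can recurse on ℕ.
atℕ : ∀ {m} → (Fin m → ℕ) → ℕ → ℕ
atℕ {zero}  f j       = 0
atℕ {suc m} f zero    = f fzero
atℕ {suc m} f (suc j) = atℕ (λ i → f (fsuc i)) j

atℕ-toℕ : ∀ {m} (f : Fin m → ℕ) i → atℕ f (toℕ i) ≡ f i
atℕ-toℕ {suc m} f fzero    = refl
atℕ-toℕ {suc m} f (fsuc i) = atℕ-toℕ (λ i → f (fsuc i)) i

even-halves : ∀ {N} → 2 ∣ N → N ≡ N / 2 + N / 2
even-halves {N} 2∣N = sym (trans (cong (N / 2 +_) (sym (+-identityʳ (N / 2)))) (m*[n/m]≡n 2∣N))

first-index : ∀ {m} → Fin m → Σ (Fin m) λ f → toℕ f ≡ 0
first-index {suc m} _ = fzero , refl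

last-index : ∀ {m} → Fin m → Σ (Fin m) λ l → suc (toℕ l) ≡ m
last-index {suc m} _ = fromℕ m , cong suc (toℕ-fromℕ m)

lengths-from-adjacent-starts : ∀ {a b L L' T} → a + L ≡ T → b + L' ≡ T → a ≡ suc b → L' ≡ suc L
lengths-from-adjacent-starts {a} {b} {L} {L'} aL bL' refl =
  +-cancelˡ-≡ b L' (suc L) (trans bL' (trans (sym aL) (sym (+-suc b L))))

lengths-to-adjacent-ends : ∀ {a L L' T} → a + L ≡ T → a + L' ≡ suc T → L' ≡ suc L
lengths-to-adjacent-ends {a} {L} {L'} aL aL' =
  +-cancelˡ-≡ a L' (suc L) (trans aL' (trans (cong suc (sym aL)) (sym (+-suc a L))))

module Chain (m : ℕ) (n : Fin m → ℕ) (even : ∀ i → n i ≡ n i / 2 + n i / 2) (nonempty : ∀ i → 1 ≤ n i) where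

  G : Graph
  G = ChainCycle m n

  infix 4 _≈_
  _≈_ : CV m n → CV m n → Set
  _≈_ = _≈C_ {m} {n}

  half : Fin m → ℕ
  half i = n i / 2

  half< : ∀ i → half i < n i
  half< i = half<N (even i) (nonempty i)

  ≈-sym : ∀ {x y : CV m n} → x ≈ y → y ≈ x
  ≈-sym = EqClosure.symmetric (Glue m n)

  ≈-pos : ∀ b {p q} → p ≡ q → (pp : p < n b) (pq : q < n b) → cv b p pp ≈ cv b q pq
  ≈-pos b refl pp pq = subst (λ z → cv b _ pp ≈ cv b _ z) (≤-irrelevant pp pq) ε

  ChainAdj-respˡ : ∀ {x y z} → x ≈ y → ChainAdj m n y z → ChainAdj m n x z
  ChainAdj-respˡ e (x' , y' , e₁ , e₂ , same , adj) = x' , y' , e ◅◅ e₁ , e₂ , same , adj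

  ChainAdj-sym : ∀ {x y} → ChainAdj m n x y → ChainAdj m n y x
  ChainAdj-sym (x' , y' , e₁ , e₂ , same , adj) =
    y' , x' , e₂ , e₁ , sym same , subst (λ b → CycAdj (n b) _ _) same (CycAdj-sym adj)

  walk-≈ʳ : ∀ {x y z k} → Walk G x y k → y ≈ z → Walk G x z k
  walk-≈ʳ (here e)        e' = here (e ◅◅ e')
  walk-≈ʳ (step adj walk) e' = step adj (walk-≈ʳ walk e')

  walk-≈ˡ : ∀ {x y z k} → x ≈ y → Walk G y z k → Walk G x z k
  walk-≈ˡ e (here e')       = here (e ◅◅ e')
  walk-≈ˡ e (step adj walk) = step (ChainAdj-respˡ e adj) walk

  walk-snoc : ∀ {x y z k} → Walk G x y k → ChainAdj m n y z → Walk G x z (suc k)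
  walk-snoc (here e)         adj = step (ChainAdj-respˡ e adj) (here ε)
  walk-snoc (step adj' walk) adj = step adj' (walk-snoc walk adj)

  walk-reverse : ∀ {x y k} → Walk G x y k → Walk G y x k
  walk-reverse (here e)        = here (≈-sym e)
  walk-reverse (step adj walk) = walk-snoc (walk-reverse walk) (ChainAdj-sym adj)

  walk-++ : ∀ {x y y' z k l} → Walk G x y k → y ≈ y' → Walk G y' z l → Walk G x z (k + l)
  walk-++ (here e)        e' walk' = walk-≈ˡ (e ◅◅ e') walk'
  walk-++ (step adj walk) e' walk' = step adj (walk-++ walk e' walk')

  Dist-sym : ∀ {x y k} → Dist G x y k → Dist G y x k
  Dist-sym (walk , shortest) = walk-reverse walk , λ k' walk' → shortest k' (walk-reverse walk')

  V₂-rigid : ∀ {u x} → InV2 m n u → u ≈ x → u ≡ x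
  V₂-rigid u∈V₂ ε = refl
  V₂-rigid {cv b p pp} u∈V₂ (_◅_ {j = cv b' q pq} (fwd glue@(b'≡1+b , _ , q≡0)) _) =
    ⊥-elim (u∈V₂ (b' , subst (1 ≤_) (sym b'≡1+b) (s≤s z≤n) , subst (_< n b') q≡0 pq ,
                  (fwd glue ◅ ε) ◅◅ ≈-pos b' q≡0 pq _))
  V₂-rigid {cv b p pp} u∈V₂ (_◅_ {j = cv b' q pq} (bwd (b≡1+b' , _ , p≡0)) _) =
    ⊥-elim (u∈V₂ (b , subst (1 ≤_) (sym b≡1+b') (s≤s z≤n) , subst (_< n b) p≡0 pp , ≈-pos b p≡0 pp _))

  blockWalk : ∀ b {a d k} → PosWalk (n b) a d k → (pa : a < n b) (pd : d < n b) → Walk G (cv b a pa) (cv b d pd) k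
  blockWalk b nil                pa pd = here (≈-pos b refl pa pd)
  blockWalk b (cons b< adj walk) pa pd = step (cv b _ pa , cv b _ b< , ε , ε , refl , adj) (blockWalk b walk b< pd)

  cycDist-blockWalk : ∀ b {p q} (pp : p < n b) (pq : q < n b) → Walk G (cv b q pq) (cv b p pp) (cycDist (n b) q p)
  cycDist-blockWalk b pp pq = blockWalk b (cycDist-walk {h = half b} (even b) (nonempty b) pp pq) pq pp

  module ChainPotential (f : CV m n → ℕ) (f-glue : ∀ {x y} → Glue m n x y → f x ≡ f y)
    (f-block : ∀ {x y} → blk x ≡ blk y → CycAdj (n (blk x)) (pos x) (pos y) → f x ≤ suc (f y)) where

    f-resp : ∀ {x y} → x ≈ y → f x ≡ f y
    f-resp ε              = refl
    f-resp (fwd glue ◅ r) = trans (f-glue glue) (f-resp r)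
    f-resp (bwd glue ◅ r) = trans (sym (f-glue glue)) (f-resp r)

    f-lipschitz : ∀ {x y} → ChainAdj m n x y → f y ≤ suc (f x)
    f-lipschitz adj with ChainAdj-sym adj
    ... | y' , x' , e₁ , e₂ , same , adj' =
      subst₂ (λ s t → s ≤ suc t) (sym (f-resp e₁)) (sym (f-resp e₂)) (f-block same adj')

    open Potential G f f-resp f-lipschitz public

  -- Distance to position q of block i, measured after projecting onto block i: earlier
  -- blocks collapse to its position 0, later blocks to its antipode half i.
  module Projection (i : Fin m) (q : ℕ) where

    project : ℕ → ℕ → ℕ
    project j p with <-cmp j (toℕ i)
    ... | tri< _ _ _ = 0
    ... | tri≈ _ _ _ = p
    ... | tri> _ _ _ = half i

    project-self : ∀ p → project (toℕ i) p ≡ p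
    project-self p with <-cmp (toℕ i) (toℕ i)
    ... | tri< i<i _ _ = ⊥-elim (<-irrefl refl i<i)
    ... | tri≈ _ _ _   = refl
    ... | tri> _ _ i>i = ⊥-elim (<-irrefl refl i>i)

    project-glue : ∀ b → project (toℕ b) (half b) ≡ project (suc (toℕ b)) 0
    project-glue b with <-cmp (toℕ b) (toℕ i) | <-cmp (suc (toℕ b)) (toℕ i)
    ... | tri< _ _ _   | tri< _ _ _    = refl
    ... | tri< _ _ _   | tri≈ _ _ _    = refl
    ... | tri< b<i _ _ | tri> _ _ b≥i  = ⊥-elim (<⇒≱ b<i (≤-pred b≥i))
    ... | tri≈ _ b≡i _ | tri< b+1<i _ _ = ⊥-elim (<-irrefl b≡i (≤-trans (n≤1+n _) b+1<i))
    ... | tri≈ _ b≡i _ | tri≈ _ b+1≡i _ = ⊥-elim (<-irrefl (trans b≡i (sym b+1≡i)) ≤-refl)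
    ... | tri≈ _ b≡i _ | tri> _ _ _    = cong half (toℕ-injective b≡i)
    ... | tri> _ _ b>i | tri< b+1<i _ _ = ⊥-elim (<-asym b>i (≤-trans (n≤1+n _) b+1<i))
    ... | tri> _ _ b>i | tri≈ _ b+1≡i _ = ⊥-elim (<-irrefl refl (≤-trans b>i (≤-trans (n≤1+n _) (≤-reflexive b+1≡i))))
    ... | tri> _ _ _   | tri> _ _ _    = refl

    ψ : CV m n → ℕ
    ψ x = cycDist (n i) q (project (toℕ (blk x)) (pos x))

    ψ-glue : ∀ {x y} → Glue m n x y → ψ x ≡ ψ y
    ψ-glue {cv b p _} {cv _ _ _} (b'≡1+b , refl , refl) rewrite b'≡1+b =
      cong (cycDist (n i) q) (project-glue b)

    ψ-block : ∀ {x y} → blk x ≡ blk y → CycAdj (n (blk x)) (pos x) (pos y) → ψ x ≤ suc (ψ y)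
    ψ-block {cv b p _} {cv .b p' _} refl adj with <-cmp (toℕ b) (toℕ i)
    ... | tri< _ _ _ = n≤1+n _
    ... | tri> _ _ _ = n≤1+n _
    ... | tri≈ _ b≡i _ with toℕ-injective b≡i
    ...   | refl = cycDist-lipschitz q (nonempty i) adj

    open ChainPotential ψ (λ {x} {y} → ψ-glue {x} {y}) (λ {x} {y} → ψ-block {x} {y}) public

  Dist-in-block : ∀ i {p q} (pp : p < n i) (pq : q < n i) → Dist G (cv i q pq) (cv i p pp) (cycDist (n i) q p)
  Dist-in-block i {p} {q} pp pq = tight⇒Dist (cycDist-blockWalk i pp pq) ψ-tight
    where
    open Projection i q
    ψ-tight : ψ (cv i q pq) + cycDist (n i) q p ≡ ψ (cv i p pp)
    ψ-tight rewrite project-self q | project-self p | cycDist-self (n i) q = refl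

  -- The level of a vertex: how far along the chain it lies.  Block j starts at level
  -- offset j = Σ_{i<j} n_i/2, and inside it the level grows with the distance from position 0.
  offset : ℕ → ℕ
  offset zero    = 0
  offset (suc j) = offset j + atℕ n j / 2

  offset-suc : ∀ b → offset (suc (toℕ b)) ≡ offset (toℕ b) + half b
  offset-suc b = cong (λ z → offset (toℕ b) + z / 2) (atℕ-toℕ n b)

  offset-mono : ∀ {j k} → j ≤ k → offset j ≤ offset k
  offset-mono {j} {k} j≤k = subst (λ z → offset j ≤ offset z) (m+[n∸m]≡n j≤k) (grow j (k ∸ j))
    where
    grow : ∀ j d → offset j ≤ offset (j + d)
    grow j zero    = ≤-reflexive (cong offset (sym (+-identityʳ j)))
    grow j (suc d) = subst (λ z → offset j ≤ offset z) (sym (+-suc j d)) (≤-trans (grow j d) (m≤m+n _ _))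

  level : CV m n → ℕ
  level x = offset (toℕ (blk x)) + dist₀ (n (blk x)) (pos x)

  level-glue : ∀ {x y} → Glue m n x y → level x ≡ level y
  level-glue {cv b _ _} {cv _ _ _} (b'≡1+b , refl , refl) rewrite b'≡1+b =
    trans (cong (offset (toℕ b) +_) (dist₀-half (even b))) (trans (sym (offset-suc b)) (sym (+-identityʳ _)))

  level-block : ∀ {x y} → blk x ≡ blk y → CycAdj (n (blk x)) (pos x) (pos y) → level x ≤ suc (level y)
  level-block {cv b _ _} refl adj =
    ≤-trans (+-monoʳ-≤ (offset (toℕ b)) (dist₀-lipschitz (n b) adj)) (≤-reflexive (+-suc _ _))

  module Level = ChainPotential level (λ {x} {y} → level-glue {x} {y}) (λ {x} {y} → level-block {x} {y})

  half≤top : ∀ b → half b ≤ offset m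
  half≤top b = ≤-trans (m≤n+m _ (offset (toℕ b))) (≤-trans (≤-reflexive (sym (offset-suc b))) (offset-mono {k = m} (toℕ<n b)))

  level≤top : ∀ x → level x ≤ offset m
  level≤top (cv b p _) = ≤-trans (+-monoʳ-≤ (offset (toℕ b)) (dist₀-≤-half (even b) p))
    (≤-trans (≤-reflexive (sym (offset-suc b))) (offset-mono {k = m} (toℕ<n b)))

  level-bottom : ∀ {i : Fin m} {pp} → toℕ i ≡ 0 → level (cv i 0 pp) ≡ 0
  level-bottom i≡0 = trans (+-identityʳ _) (cong offset i≡0)

  level-top : ∀ {k : Fin m} {pk} → suc (toℕ k) ≡ m → level (cv k (half k) pk) ≡ offset m
  level-top {k} k-last =
    trans (cong (offset (toℕ k) +_) (dist₀-half (even k))) (trans (sym (offset-suc k)) (cong offset k-last))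

  record Ascent (x y : CV m n) : Set where
    field
      len   : ℕ
      walk  : Walk G x y len
      tight : level x + len ≡ level y
  open Ascent

  Ascent⇒Dist : ∀ {x y} (A : Ascent x y) → Dist G x y (len A)
  Ascent⇒Dist A = Level.tight⇒Dist (walk A) (tight A)

  ascent-++ : ∀ {x y y' z} → Ascent x y → y ≈ y' → Ascent y' z → Ascent x z
  ascent-++ {x} A e B = record
    { len   = len A + len B
    ; walk  = walk-++ (walk A) e (walk B)
    ; tight = trans (sym (+-assoc (level x) (len A) (len B)))
                (trans (cong (_+ len B) (trans (tight A) (Level.f-resp e))) (tight B)) }

  ascent-len≤top : ∀ {x y} (A : Ascent x y) → len A ≤ offset m
  ascent-len≤top {x} {y} A = ≤-trans (m≤n+m (len A) (level x)) (subst (_≤ offset m) (sym (tight A)) (level≤top y))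

  ascent-spans : ∀ {i k : Fin m} {pi pk} → toℕ i ≡ 0 → suc (toℕ k) ≡ m
               → (A : Ascent (cv i 0 pi) (cv k (half k) pk)) → len A ≡ offset m
  ascent-spans {i} {k} {pi} {pk} i-first k-last A =
    trans (cong (_+ len A) (sym (level-bottom {i} {pi} i-first))) (trans (tight A) (level-top {k} {pk} k-last))

  ascent-from-0 : ∀ j {q} (pq : q < n j) → Ascent (cv j 0 (nonempty j)) (cv j q pq)
  ascent-from-0 j pq = record
    { len = _ ; walk = blockWalk j (walk-from-0 {h = half j} (even j) pq) (nonempty j) pq
    ; tight = cong (_+ _) (+-identityʳ (offset (toℕ j))) }

  ascent-to-half : ∀ i {p} (pp : p < n i) → Ascent (cv i p pp) (cv i (half i) (half< i))
  ascent-to-half i {p} pp = record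
    { len = proj₁ W ; walk = blockWalk i (proj₁ (proj₂ W)) pp (half< i)
    ; tight = trans (+-assoc (offset (toℕ i)) _ _)
                (cong (offset (toℕ i) +_) (trans (proj₂ (proj₂ W)) (sym (dist₀-half (even i))))) }
    where W = walk-to-antipode {h = half i} (even i) pp

  glue-next : ∀ (j j' : Fin m) → toℕ j' ≡ suc (toℕ j) → cv j (half j) (half< j) ≈ cv j' 0 (nonempty j')
  glue-next j j' j'≡1+j = fwd (j'≡1+j , refl , refl) ◅ ε

  next-block : ∀ (j : Fin m) → suc (toℕ j) < m → Σ (Fin m) λ j' → toℕ j' ≡ suc (toℕ j)
  next-block j lt = fromℕ< lt , toℕ-fromℕ< lt

  ascent-from-base : ∀ d {j k : Fin m} → d + toℕ j ≡ toℕ k → ∀ {q} (pq : q < n k) → Ascent (cv j 0 (nonempty j)) (cv k q pq)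
  ascent-from-base zero {j} j≡k pq with toℕ-injective j≡k
  ... | refl = ascent-from-0 j pq
  ascent-from-base (suc d) {j} {k} d+1+j≡k pq =
    ascent-++ (ascent-to-half j (nonempty j)) (glue-next j j' j'≡1+j)
      (ascent-from-base d (trans (cong (d +_) j'≡1+j) (trans (+-suc d (toℕ j)) d+1+j≡k)) pq)
    where
    1+j<m = ≤-trans (s≤s (≤-trans (s≤s (m≤n+m (toℕ j) d)) (≤-reflexive d+1+j≡k))) (toℕ<n k)
    j' = proj₁ (next-block j 1+j<m)
    j'≡1+j = proj₂ (next-block j 1+j<m)

  ascent-up : ∀ {i k : Fin m} {p q} (pp : p < n i) (pq : q < n k) → toℕ i < toℕ k → Ascent (cv i p pp) (cv k q pq)
  ascent-up {i} {k} pp pq i<k =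
    ascent-++ (ascent-to-half i pp) (glue-next i i' i'≡1+i)
      (ascent-from-base (toℕ k ∸ suc (toℕ i)) (trans (cong (toℕ k ∸ suc (toℕ i) +_) i'≡1+i) (m∸n+n≡m i<k)) pq)
    where
    i' = proj₁ (next-block i (≤-trans (s≤s i<k) (toℕ<n k)))
    i'≡1+i = proj₂ (next-block i (≤-trans (s≤s i<k) (toℕ<n k)))

  short-walk : ∀ x y → Σ ℕ λ L → Walk G x y L × L ≤ offset m
  short-walk (cv i p pp) (cv k q pq) with <-cmp (toℕ i) (toℕ k)
  ... | tri< i<k _ _ = let A = ascent-up pp pq i<k in len A , walk A , ascent-len≤top A
  ... | tri> _ _ k<i = let A = ascent-up pq pp k<i in len A , walk-reverse (walk A) , ascent-len≤top A
  ... | tri≈ _ i≡k _ with toℕ-injective i≡k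
  ...   | refl = _ , cycDist-blockWalk i pq pp , ≤-trans (cycDist-≤-half (even i) p q) (half≤top i)

  chain-diameter : Fin m → IsDiameter G (offset m)
  chain-diameter i₀ =
    (_ , _ , subst (Dist G _ _) (ascent-spans f≡0 l-last A) (Ascent⇒Dist A)) ,
    λ x y k d → ≤-trans (proj₂ d _ (proj₁ (proj₂ (short-walk x y)))) (proj₂ (proj₂ (short-walk x y)))
    where
    f = proj₁ (first-index i₀)
    f≡0 = proj₂ (first-index i₀)
    l = proj₁ (last-index i₀)
    l-last = proj₂ (last-index i₀)
    A = ascent-from-base (toℕ l) {f} {l} (trans (cong (toℕ l +_) f≡0) (+-identityʳ _)) (half< l)

  -- (a) Two vertices of one block.
  -- If u ∈ V₂ is antipodal to v in block i, every neighbour of u lies in block i and so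
  -- within distance half i of v: u is maximally distant from v.
  antipodal⇒maxDist : ∀ {i p q} (pp : p < n i) (pq : q < n i) → InV2 m n (cv i p pp)
                    → Dist G (cv i p pp) (cv i q pq) (half i) → MaxDistFrom G (cv i p pp) (cv i q pq)
  antipodal⇒maxDist {i} {q = q} pp pq u∈V₂ d-half w (x' , cv _ p' pp' , u≈x' , w≈y' , refl , _) a b dvw duv
    with V₂-rigid u∈V₂ u≈x'
  ... | refl = subst (a ≤_) (Dist-unique G d-half duv)
                 (≤-trans (proj₂ dvw _ (walk-≈ʳ (cycDist-blockWalk i pp' pq) (≈-sym w≈y')))
                          (cycDist-≤-half (even i) q p'))

  -- If u is maximally distant from v in the same block, it is antipodal to v: otherwise a
  -- neighbour of u one step farther from v exists.
  maxDist⇒antipodal : ∀ {i p q} (pp : p < n i) (pq : q < n i)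
                    → MaxDistFrom G (cv i p pp) (cv i q pq) → cycDist (n i) q p ≡ half i
  maxDist⇒antipodal {i} {p} {q} pp pq u-max with cycDist (n i) q p <? half i
  ... | no ¬d<h = ≤-antisym (cycDist-≤-half (even i) q p) (≮⇒≥ ¬d<h)
  ... | yes d<h = ⊥-elim (farther-neighbour G adj (subst (Dist G _ _) farther (Dist-in-block i p'< pq))
                                             (Dist-sym (Dist-in-block i pp pq)) u-max)
    where
    F = cycDist-away q (even i) (nonempty i) pp d<h
    p'< = proj₁ (proj₂ F)
    adj : ChainAdj m n (cv i p pp) (cv i _ p'<)
    adj = _ , _ , ε , ε , refl , proj₁ (proj₂ (proj₂ F))
    farther = proj₂ (proj₂ (proj₂ F))

  same-block : ∀ i {p q} (pp : p < n i) (pq : q < n i) → InV2 m n (cv i p pp) → InV2 m n (cv i q pq)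
    → MutuallyMaxDist G (cv i p pp) (cv i q pq)
      ⇔ (∀ D → IsDiameter (CycleGraph (n i)) D → Dist G (cv i p pp) (cv i q pq) D)
  same-block i pp pq u∈V₂ v∈V₂ = mk⇔
    (λ (u-max , _) D diam → subst (Dist G _ _)
       (trans (maxDist⇒antipodal pp pq u-max) (diameter-unique (CycleGraph (n i)) cycle-diam diam))
       (Dist-sym (Dist-in-block i pp pq)))
    (λ at-diam → let d = at-diam (half i) cycle-diam in
       antipodal⇒maxDist pp pq u∈V₂ d , antipodal⇒maxDist pq pp v∈V₂ (Dist-sym d))
    where cycle-diam = cycle-diameter (even i) (nonempty i)

  -- If u = (i,p) is maximally distant from v then p = 0: otherwise the neighbour of u one
  -- step nearer to position 0 lies one level lower and hence one step farther from v.
  maxDist⇒base : ∀ {i k : Fin m} {p q} (pp : p < n i) (pq : q < n k) → toℕ i < toℕ k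
               → MaxDistFrom G (cv i p pp) (cv k q pq) → p ≡ 0
  maxDist⇒base {i} {p = p} pp pq i<k u-max with p ≟ 0
  ... | yes p≡0 = p≡0
  ... | no  p≢0 = ⊥-elim (farther-neighbour G adj (subst (Dist G _ _) longer (Dist-sym (Ascent⇒Dist A')))
                                             (Ascent⇒Dist A) u-max)
    where
    C = towards-0 {h = half i} (even i) pp p≢0
    p'< = proj₁ (proj₂ C)
    adj : ChainAdj m n (cv i p pp) (cv i _ p'<)
    adj = _ , _ , ε , ε , refl , proj₁ (proj₂ (proj₂ C))
    A = ascent-up pp pq i<k
    A' = ascent-up p'< pq i<k
    longer : len A' ≡ suc (len A)
    longer = lengths-from-adjacent-starts {a = level (cv i p pp)} (tight A) (tight A')
               (trans (cong (offset (toℕ i) +_) (sym (proj₂ (proj₂ (proj₂ C))))) (+-suc _ _))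

  -- If v = (k,q) is maximally distant from u then q = half k: otherwise the neighbour of v
  -- one step farther from position 0 lies one level higher and hence one step farther from u.
  maxDist⇒antipode : ∀ {i k : Fin m} {p q} (pp : p < n i) (pq : q < n k) → toℕ i < toℕ k
                   → MaxDistFrom G (cv k q pq) (cv i p pp) → q ≡ half k
  maxDist⇒antipode {i} {k} {p} {q} pp pq i<k v-max with dist₀ (n k) q <? half k
  ... | no ¬d<h = dist₀≡half⇒antipode (even k) pq (≤-antisym (dist₀-≤-half (even k) q) (≮⇒≥ ¬d<h))
  ... | yes d<h = ⊥-elim (farther-neighbour G adj (subst (Dist G _ _) longer (Ascent⇒Dist A'))
                                             (Dist-sym (Ascent⇒Dist A)) v-max)
    where
    F = away-from-0 {h = half k} (even k) pq d<h
    q'< = proj₁ (proj₂ F)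
    adj : ChainAdj m n (cv k q pq) (cv k _ q'<)
    adj = _ , _ , ε , ε , refl , proj₁ (proj₂ (proj₂ F))
    A = ascent-up pp pq i<k
    A' = ascent-up pp q'< i<k
    longer : len A' ≡ suc (len A)
    longer = lengths-to-adjacent-ends {a = level (cv i p pp)} (tight A)
               (trans (tight A') (trans (cong (offset (toℕ k) +_) (proj₂ (proj₂ (proj₂ F)))) (+-suc _ _)))

  -- Position 0 of a block other than the first, and the antipode of a block other than
  -- the last, are glued vertices and so lie in V₁.
  V₂-base⇒first : ∀ {i : Fin m} {pp} → InV2 m n (cv i 0 pp) → toℕ i ≡ 0
  V₂-base⇒first {i} {pp} u∈V₂ with toℕ i ≟ 0
  ... | yes i≡0 = i≡0
  ... | no  i≢0 = ⊥-elim (u∈V₂ (i , n≢0⇒n>0 i≢0 , pp , ε))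

  V₂-antipode⇒last : ∀ {k : Fin m} {pk} → InV2 m n (cv k (half k) pk) → suc (toℕ k) ≡ m
  V₂-antipode⇒last {k} v∈V₂ with suc (toℕ k) ≟ m
  ... | yes k-last = k-last
  ... | no  ¬last  = ⊥-elim (v∈V₂ (k' , subst (1 ≤_) (sym k'≡1+k) (s≤s z≤n) , nonempty k' ,
                                   fwd (k'≡1+k , refl , refl) ◅ ε))
    where
    k' = proj₁ (next-block k (≤∧≢⇒< (toℕ<n k) ¬last))
    k'≡1+k = proj₂ (next-block k (≤∧≢⇒< (toℕ<n k) ¬last))

  mutuallyMaxDist⇒diametral : ∀ {i k : Fin m} {p q} (pp : p < n i) (pq : q < n k) → toℕ i < toℕ k
    → InV2 m n (cv i p pp) → InV2 m n (cv k q pq) → MutuallyMaxDist G (cv i p pp) (cv k q pq)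
    → Dist G (cv i p pp) (cv k q pq) (offset m)
  mutuallyMaxDist⇒diametral pp pq i<k u∈V₂ v∈V₂ (u-max , v-max)
    with maxDist⇒base pp pq i<k u-max | maxDist⇒antipode pp pq i<k v-max
  ... | refl | refl = subst (Dist G _ _) (ascent-spans (V₂-base⇒first u∈V₂) (V₂-antipode⇒last v∈V₂) A)
                        (Ascent⇒Dist A)
    where A = ascent-up pp pq i<k

  different-blocks : ∀ u v → InV2 m n u → InV2 m n v → ¬ (blk u ≡ blk v)
    → MutuallyMaxDist G u v ⇔ (∀ D → IsDiameter G D → Dist G u v D)
  different-blocks (cv i p pp) (cv k q pq) u∈V₂ v∈V₂ i≢k = mk⇔
    (λ mmd D diam → subst (Dist G _ _) (diameter-unique G chain-diam diam) (at-top mmd))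
    (λ at-diam → let d = at-diam (offset m) chain-diam in diametral⇒mutuallyMaxDist G chain-diam d (Dist-sym d))
    where
    chain-diam = chain-diameter i
    at-top : MutuallyMaxDist G (cv i p pp) (cv k q pq) → Dist G (cv i p pp) (cv k q pq) (offset m)
    at-top mmd with <-cmp (toℕ i) (toℕ k)
    ... | tri< i<k _ _ = mutuallyMaxDist⇒diametral pp pq i<k u∈V₂ v∈V₂ mmd
    ... | tri≈ _ i≡k _ = ⊥-elim (i≢k (toℕ-injective i≡k))
    ... | tri> _ _ k<i = Dist-sym (mutuallyMaxDist⇒diametral pq pp k<i v∈V₂ u∈V₂ (proj₂ mmd , proj₁ mmd))

theorem3p3 : (m : ℕ) (n : Fin m → ℕ)
    → (∀ i → 2 ∣ n i) → (∀ i → 4 ≤ n i)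
    → (u v : CV m n) → InV2 m n u → InV2 m n v
    → ((blk u ≡ blk v)
        → (MutuallyMaxDist (ChainCycle m n) u v
           ⇔ (∀ D → IsDiameter (CycleGraph (n (blk u))) D
                  → Dist (ChainCycle m n) u v D)))
      × (¬ (blk u ≡ blk v)
        → (MutuallyMaxDist (ChainCycle m n) u v
           ⇔ (∀ D → IsDiameter (ChainCycle m n) D
                  → Dist (ChainCycle m n) u v D)))
theorem3p3 m n 2∣n 4≤n (cv i p pp) v u∈V₂ v∈V₂ =
  (λ { refl → same-block i pp (pos<n v) u∈V₂ v∈V₂ }) ,
  different-blocks (cv i p pp) v u∈V₂ v∈V₂
  where open Chain m n (λ i → even-halves (2∣n i)) (λ i → ≤-trans (s≤s z≤n) (4≤n i))
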